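{- Let $T$ be a tree on $n\ge 2$ vertices, and for each $i$ let $d_i$ be the number of vertices of degree $i$ in $T$. Then (a) $d_1-\mathrm{bad}(T)\ge 2+\sum_{i\ge 4} d_i$; (b) $d_1\ge \frac{2}{3}(n-d_2-d_3)$; (c) $\sum_{i\ge 4} d_i\le \frac{1}{3}(n-d_2-d_3)$.
   Context: For a vertex $x$ of degree at least $3$ in a tree $T$, the connected components of $T-x$ that are paths are called pendent paths of $x$. A vertex $x$ of degree at least $3$ is called bad if it has an odd number of pendent paths. $\mathrm{bad}(T)$ denotes the number of bad vertices of $T$. -}

module Defs where

open import Data.Nat using (ℕ; zero; suc; _≡ᵇ_; _+_; _*_; _∸_; _≤_; _≥_)
open import Data.Nat.Properties using (_≟_)
open import Data.Fin using (Fin; toℕ) renaming (_≤_ to _≤ᶠ_)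
open import Data.Bool using (Bool; true; false; if_then_else_)
open import Data.Nat.ListAction using (sum)
open import Data.List using (List; []; _∷_; length; lookup; map; applyUpTo; filter; allFin)
open import Data.List.Membership.Propositional using (_∈_)
open import Data.List.Relation.Unary.Unique.Propositional using (Unique)
open import Data.List.Relation.Unary.Linked using (Linked)
open import Data.Maybe using (Maybe; just; nothing)
open import Data.Product using (Σ; ∃; _×_; _,_)
open import Data.Sum using (_⊎_)
open import Data.Unit using (⊤)
open import Data.Empty using (⊥)
open import Relation.Nullary using (¬_)
open import Relation.Binary.PropositionalEquality using (_≡_; _≢_)
open import Function.Bundles using (_⇔_)

record Graph (n : ℕ) : Set where
  field
    adj     : Fin n → Fin n → Bool
    sym     : ∀ u v → adj u v ≡ adj v u
    irrefl  : ∀ v → adj v v ≡ false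
open Graph public

Adj : ∀ {n} → Graph n → Fin n → Fin n → Set
Adj G u v = adj G u v ≡ true

deg : ∀ {n} → Graph n → Fin n → ℕ
deg {n} G v = sum (map (λ w → if adj G v w then 1 else 0) (allFin n))

d : ∀ {n} → Graph n → ℕ → ℕ
d {n} G i = sum (map (λ v → if (deg G v ≡ᵇ i) then 1 else 0) (allFin n))

-- Σ_{i ≥ 4} d_i ; degrees are < n, so summing i = 4,…,n is the full sum
sumDeg≥4 : ∀ {n} → Graph n → ℕ
sumDeg≥4 {n} G = sum (map (d G) (applyUpTo (4 +_) (n ∸ 3)))

data WalkIn {n} (G : Graph n) (P : Fin n → Set) : Fin n → Fin n → Set where
  here : ∀ {u} → P u → WalkIn G P u u
  step : ∀ {u w v} → P u → Adj G u w → WalkIn G P w v → WalkIn G P u v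

Connected : ∀ {n} → Graph n → Set
Connected G = ∀ u v → WalkIn G (λ _ → ⊤) u v

lastOf : ∀ {n} → Fin n → List (Fin n) → Fin n
lastOf x [] = x
lastOf x (y ∷ ys) = lastOf y ys

IsCycle : ∀ {n} → Graph n → List (Fin n) → Set
IsCycle G [] = ⊥
IsCycle G (v ∷ vs) =
  (3 ≤ length (v ∷ vs)) × Unique (v ∷ vs) × Linked (Adj G) (v ∷ vs)
  × Adj G (lastOf v vs) v

Acyclic : ∀ {n} → Graph n → Set
Acyclic {n} G = ∀ (cs : List (Fin n)) → ¬ IsCycle G cs

IsTree : ∀ {n} → Graph n → Set
IsTree G = Connected G × Acyclic G

-- u and v lie in the same connected component of G - x
ConnAvoid : ∀ {n} → Graph n → Fin n → Fin n → Fin n → Set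
ConnAvoid G x u v = WalkIn G (λ w → w ≢ x) u v

InducedPath : ∀ {n} → Graph n → List (Fin n) → Set
InducedPath G vs = Unique vs ×
  (∀ (i j : Fin (length vs)) →
     Adj G (lookup vs i) (lookup vs j) ⇔ (toℕ i ≡ suc (toℕ j) ⊎ toℕ j ≡ suc (toℕ i)))

ComponentIsPath : ∀ {n} → Graph n → Fin n → Fin n → Set
ComponentIsPath {n} G x u = Σ (List (Fin n)) λ vs →
  (∀ v → v ∈ vs ⇔ ConnAvoid G x u v) × InducedPath G vs

ComponentRep : ∀ {n} → Graph n → Fin n → Fin n → Set
ComponentRep G x u = u ≢ x × (∀ v → ConnAvoid G x u v → u ≤ᶠ v)

-- components of G - x that are paths, represented by their least vertex
PendentPathRep : ∀ {n} → Graph n → Fin n → Fin n → Set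
PendentPathRep G x u = ComponentRep G x u × ComponentIsPath G x u

HasCount : ∀ {n} → (Fin n → Set) → ℕ → Set
HasCount {n} P k = Σ (List (Fin n)) λ xs →
  Unique xs × (∀ x → x ∈ xs ⇔ P x) × length xs ≡ k

Odd : ℕ → Set
Odd k = Σ ℕ λ m → k ≡ suc (2 * m)

Bad : ∀ {n} → Graph n → Fin n → Set
Bad G x = deg G x ≥ 3 × Σ ℕ λ k → HasCount (PendentPathRep G x) k × Odd k

-- Every bad vertex has degree at least 3, so bad(T) ≤ d₃ + Σ_{i≥4} dᵢ. All three bounds then follow from the leaf count
-- d₁ ≥ 2 + d₃ + 2 Σ_{i≥4} dᵢ, which is the tree handshake bound Σ_v deg v ≤ 2n − 2 read off
-- degree class by degree class (a vertex of degree m contributes m − 2 to Σ_v (deg v − 2) ≤ −2).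
-- The handshake bound is proved by pruning leaves: an acyclic graph with an edge has a leaf,
-- since otherwise every path could be extended forever inside a finite graph.

module Submission where

open import Defs hiding (sym)
open import Data.Nat using (ℕ; zero; suc; _+_; _*_; _∸_; _≤_; _<_; _≥_; z≤n; s≤s; _≡ᵇ_)
open import Data.Nat.Properties
open import Data.Nat.ListAction using (sum)
open import Data.Fin using (Fin; zero; suc)
import Data.Fin.Properties as Fin
open import Data.List using (List; []; _∷_; length; map; tabulate; allFin; applyUpTo)
open import Data.List.Properties using (map-tabulate; map-applyUpTo; map-cong)
open import Data.List.Membership.Propositional using (_∈_)
open import Data.List.Relation.Unary.Any using (here; there)
open import Data.List.Relation.Unary.All using (All; []; _∷_)
open import Data.List.Relation.Unary.All.Properties using (All¬⇒¬Any; ¬Any⇒All¬)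
open import Data.List.Relation.Unary.AllPairs using ([]; _∷_)
open import Data.List.Relation.Unary.Unique.Propositional using (Unique)
open import Data.List.Relation.Unary.Linked using (Linked; []; [-]; _∷_) renaming (map to Linked-map)
open import Data.Bool using (Bool; true; false; if_then_else_; _∧_; not)
import Data.Bool.Properties as Bool
open import Data.Product using (∃; _×_; _,_; proj₁; proj₂)
open import Data.Empty using (⊥-elim)
open import Relation.Nullary using (¬?; _×-dec_; yes; no; does)
open import Relation.Nullary.Decidable using (dec-true; dec-false)
open import Relation.Binary.PropositionalEquality
open import Data.Nat.Induction using (<-rec)
open import Data.Nat.Solver using (module +-*-Solver)
open import Function using (_∘_)
open import Function.Bundles using (Equivalence)
open import Algebra.Properties.CommutativeSemigroup +-commutativeSemigroup using (xy∙z≈zy∙x; x∙yz≈y∙xz)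
open import Algebra.Properties.CommutativeMonoid.Sum +-0-commutativeMonoid
  using (sum-cong-≗; ∑-distrib-+) renaming (sum to ∑)

private
  variable
    n : ℕ

sum-tabulate : (f : Fin n → ℕ) → sum (tabulate f) ≡ ∑ f
sum-tabulate {zero}  f = refl
sum-tabulate {suc n} f = cong (f zero +_) (sum-tabulate (λ i → f (suc i)))

sum-map-allFin : (f : Fin n → ℕ) → sum (map f (allFin n)) ≡ ∑ f
sum-map-allFin f = trans (cong sum (map-tabulate (λ i → i) f)) (sum-tabulate f)

∑-const : ∀ c → ∑ {n} (λ _ → c) ≡ n * c
∑-const {zero}  c = refl
∑-const {suc n} c = cong (c +_) (∑-const {n} c)

∑-zero : {f : Fin n → ℕ} → (∀ v → f v ≡ 0) → ∑ f ≡ 0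
∑-zero {n} f≡0 = trans (sum-cong-≗ f≡0) (trans (∑-const {n} 0) (*-zeroʳ n))

sum-map-∑ : {A : Set} (F : A → Fin n → ℕ) (xs : List A) →
            sum (map (λ a → ∑ (F a)) xs) ≡ ∑ (λ v → sum (map (λ a → F a v) xs))
sum-map-∑ {n} F []       = sym (∑-zero {n} (λ _ → refl))
sum-map-∑     F (a ∷ xs) = trans (cong (∑ (F a) +_) (sum-map-∑ F xs)) (sym (∑-distrib-+ (F a) _))

∑-mono-≤ : {f g : Fin n → ℕ} → (∀ v → f v ≤ g v) → ∑ f ≤ ∑ g
∑-mono-≤ {zero}  f≤g = z≤n
∑-mono-≤ {suc n} f≤g = +-mono-≤ (f≤g zero) (∑-mono-≤ (λ v → f≤g (suc v)))

term≤∑ : (f : Fin n → ℕ) (u : Fin n) → f u ≤ ∑ f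
term≤∑ f zero    = m≤m+n _ _
term≤∑ f (suc u) = ≤-trans (term≤∑ (λ v → f (suc v)) u) (m≤n+m _ _)

∑-positive : (f : Fin n → ℕ) → 1 ≤ ∑ f → ∃ λ u → 1 ≤ f u
∑-positive {suc n} f pos with f zero in eq
... | suc _ = zero , subst (1 ≤_) (sym eq) (s≤s z≤n)
... | zero  = let u , fu = ∑-positive (λ v → f (suc v)) pos in suc u , fu

∑-update : {f g : Fin n → ℕ} (u : Fin n) → (∀ v → v ≢ u → f v ≡ g v) → ∑ f + g u ≡ ∑ g + f u
∑-update {suc n} {f} {g} zero f≗g
  rewrite sum-cong-≗ {n} (λ v → f≗g (suc v) λ ()) = xy∙z≈zy∙x (f zero) _ (g zero)
∑-update {suc n} {f} {g} (suc u) f≗g = begin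
  f zero + ∑ (λ v → f (suc v)) + g (suc u)   ≡⟨ +-assoc (f zero) _ _ ⟩
  f zero + (∑ (λ v → f (suc v)) + g (suc u)) ≡⟨ cong₂ _+_ (f≗g zero λ ()) (∑-update u λ v v≢u → f≗g (suc v) (v≢u ∘ Fin.suc-injective)) ⟩
  g zero + (∑ (λ v → g (suc v)) + f (suc u)) ≡⟨ +-assoc (g zero) _ _ ⟨
  g zero + ∑ (λ v → g (suc v)) + f (suc u)   ∎
  where open ≡-Reasoning

∑-bump : {f g : Fin n → ℕ} (u : Fin n) {k : ℕ} → (∀ v → f v ≤ g v) → k + f u ≤ g u → k + ∑ f ≤ ∑ g
∑-bump {suc n} {f} {g} zero {k} f≤g bump = begin
  k + (f zero + ∑ (λ v → f (suc v))) ≡⟨ +-assoc k _ _ ⟨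
  k + f zero + ∑ (λ v → f (suc v))   ≤⟨ +-mono-≤ bump (∑-mono-≤ (λ v → f≤g (suc v))) ⟩
  ∑ g                                ∎
  where open ≤-Reasoning
∑-bump {suc n} {f} {g} (suc u) {k} f≤g bump = begin
  k + (f zero + ∑ (λ v → f (suc v))) ≡⟨ x∙yz≈y∙xz k (f zero) _ ⟩
  f zero + (k + ∑ (λ v → f (suc v))) ≤⟨ +-mono-≤ (f≤g zero) (∑-bump u (λ v → f≤g (suc v)) bump) ⟩
  ∑ g                                ∎
  where open ≤-Reasoning

𝟙 : Bool → ℕ
𝟙 b = if b then 1 else 0

𝟙≤1 : ∀ b → 𝟙 b ≤ 1
𝟙≤1 true  = ≤-refl
𝟙≤1 false = z≤n

𝟙-mono : ∀ {a b} → (a ≡ true → b ≡ true) → 𝟙 a ≤ 𝟙 b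
𝟙-mono {false}         _   = z≤n
𝟙-mono {true} {true}   _   = ≤-refl
𝟙-mono {true} {false} a⇒b with () ← a⇒b refl

length≤∑ : {f : Fin n → ℕ} {xs : List (Fin n)} → Unique xs → (∀ {v} → v ∈ xs → 1 ≤ f v) → length xs ≤ ∑ f
length≤∑ {xs = []} _ _ = z≤n
length≤∑ {f = f} {x ∷ xs} (x∉xs ∷ uniq) pos =
  ≤-trans (s≤s (length≤∑ uniq λ v∈xs → subst (1 ≤_) (sym (f′≡f v∈xs)) (pos (there v∈xs))))
          (∑-bump {f = f′} x (λ v → m∸n≤m (f v) (𝟙 (does (v Fin.≟ x)))) take-x)
  where
  f′ : Fin _ → ℕ
  f′ v = f v ∸ 𝟙 (does (v Fin.≟ x))
  take-x : 1 + f′ x ≤ f x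
  take-x rewrite dec-true (x Fin.≟ x) refl = ≤-reflexive (m+[n∸m]≡n (pos (here refl)))
  f′≡f : ∀ {v} → v ∈ xs → f′ v ≡ f v
  f′≡f {v} v∈xs rewrite dec-false (v Fin.≟ x) (λ { refl → All¬⇒¬Any x∉xs v∈xs }) = refl

Unique⇒length≤n : {xs : List (Fin n)} → Unique xs → length xs ≤ n
Unique⇒length≤n {n} uniq = ≤-trans (length≤∑ uniq (λ _ → ≤-refl)) (≤-reflexive (trans (∑-const {n} 1) (*-identityʳ n)))

module _ {A : Set} {w : A} where

  takeThrough : {zs : List A} → w ∈ zs → List A
  takeThrough {z ∷ _} (here _)     = z ∷ []
  takeThrough {z ∷ _} (there w∈zs) = z ∷ takeThrough w∈zs

  All-takeThrough : ∀ {P : A → Set} {zs} (w∈zs : w ∈ zs) → All P zs → All P (takeThrough w∈zs)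
  All-takeThrough (here _)     (pz ∷ _)  = pz ∷ []
  All-takeThrough (there w∈zs) (pz ∷ ps) = pz ∷ All-takeThrough w∈zs ps

  Unique-takeThrough : ∀ {zs} (w∈zs : w ∈ zs) → Unique zs → Unique (takeThrough w∈zs)
  Unique-takeThrough (here _)     (_ ∷ _)      = [] ∷ []
  Unique-takeThrough (there w∈zs) (z∉ ∷ uniq) = All-takeThrough w∈zs z∉ ∷ Unique-takeThrough w∈zs uniq

  Linked-takeThrough : ∀ {R : A → A → Set} {a zs} (w∈zs : w ∈ zs) →
                       Linked R (a ∷ zs) → Linked R (a ∷ takeThrough w∈zs)
  Linked-takeThrough (here _)                (r ∷ _)    = r ∷ [-]
  Linked-takeThrough (there w∈zs) (r ∷ rs) = r ∷ Linked-takeThrough w∈zs rs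

lastOf-takeThrough : ∀ {w : Fin n} a {zs} (w∈zs : w ∈ zs) → lastOf a (takeThrough w∈zs) ≡ w
lastOf-takeThrough a (here refl)  = refl
lastOf-takeThrough a (there w∈zs) = lastOf-takeThrough _ w∈zs

module _ (G : Graph n) where

  open import Data.List.Membership.DecPropositional (Fin._≟_ {n}) using (_∈?_)

  Adj-sym : ∀ {u v} → Adj G u v → Adj G v u
  Adj-sym {u} {v} uv = trans (Graph.sym G v u) uv

  Adj⇒≢ : ∀ {u v} → Adj G u v → u ≢ v
  Adj⇒≢ {u} uu refl with () ← trans (sym uu) (irrefl G u)

  deg-∑ : ∀ v → deg G v ≡ ∑ (λ w → 𝟙 (adj G v w))
  deg-∑ v = sum-map-allFin (λ w → 𝟙 (adj G v w))

  Adj⇒deg-pos : ∀ {u v} → Adj G u v → 1 ≤ deg G u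
  Adj⇒deg-pos {u} {v} uv = subst (1 ≤_) (sym (deg-∑ u))
    (≤-trans (≤-reflexive (cong 𝟙 (sym uv))) (term≤∑ (λ w → 𝟙 (adj G u w)) v))

  deg-pos⇒Adj : ∀ {u} → 1 ≤ deg G u → ∃ λ v → Adj G u v
  deg-pos⇒Adj {u} pos with ∑-positive (λ w → 𝟙 (adj G u w)) (subst (1 ≤_) (deg-∑ u) pos)
  ... | v , uv with adj G u v in eq
  ...   | true = v , eq

  deg≤n : ∀ v → deg G v ≤ n
  deg≤n v = begin
    deg G v                    ≡⟨ deg-∑ v ⟩
    ∑ (λ w → 𝟙 (adj G v w))    ≤⟨ ∑-mono-≤ (λ w → 𝟙≤1 (adj G v w)) ⟩
    ∑ {n} (λ _ → 1)            ≡⟨ ∑-const {n} 1 ⟩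
    n * 1                      ≡⟨ *-identityʳ n ⟩
    n                          ∎
    where open ≤-Reasoning

  another-neighbour : ∀ {v} → 2 ≤ deg G v → ∀ p → ∃ λ w → Adj G v w × w ≢ p
  another-neighbour {v} two p with Fin.any? (λ w → (adj G v w Bool.≟ true) ×-dec ¬? (w Fin.≟ p))
  ... | yes found = found
  ... | no none = ⊥-elim (<⇒≱ two (begin
    deg G v                                ≡⟨ deg-∑ v ⟩
    ∑ (λ w → 𝟙 (adj G v w))                ≡⟨ +-identityʳ _ ⟨
    ∑ (λ w → 𝟙 (adj G v w)) + 0            ≡⟨ ∑-update p only-p ⟩
    ∑ {n} (λ _ → 0) + 𝟙 (adj G v p)        ≡⟨ cong (_+ 𝟙 (adj G v p)) (trans (∑-const {n} 0) (*-zeroʳ n)) ⟩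
    𝟙 (adj G v p)                          ≤⟨ 𝟙≤1 (adj G v p) ⟩
    1                                      ∎))
    where
    open ≤-Reasoning
    only-p : ∀ w → w ≢ p → 𝟙 (adj G v w) ≡ 0
    only-p w w≢p with adj G v w in eq
    ... | true  = ⊥-elim (none (w , eq , w≢p))
    ... | false = refl

  Path : List (Fin n) → Set
  Path vs = Unique vs × Linked (Adj G) vs

  chord⇒cycle : ∀ {x y w rest} → Path (x ∷ y ∷ rest) → (w∈rest : w ∈ rest) → Adj G x w →
                IsCycle G (x ∷ y ∷ takeThrough w∈rest)
  chord⇒cycle ((x≢y ∷ x∉rest) ∷ (y∉rest ∷ uniq) , xy ∷ linked) w∈rest xw =
    s≤s (s≤s (nonempty w∈rest)) ,
    (x≢y ∷ All-takeThrough w∈rest x∉rest) ∷ (All-takeThrough w∈rest y∉rest ∷ Unique-takeThrough w∈rest uniq) ,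
    xy ∷ Linked-takeThrough w∈rest linked ,
    subst (λ z → Adj G z _) (sym (lastOf-takeThrough _ w∈rest)) (Adj-sym xw)
    where
    nonempty : ∀ {w : Fin n} {rest} (w∈rest : w ∈ rest) → 1 ≤ length (takeThrough w∈rest)
    nonempty (here _)  = s≤s z≤n
    nonempty (there _) = s≤s z≤n

  extend-path : Acyclic G → ∀ {x y rest} → 2 ≤ deg G x → Path (x ∷ y ∷ rest) →
                ∃ λ w → Path (w ∷ x ∷ y ∷ rest)
  extend-path acyclic {x} {y} {rest} two path@(uniq , linked)
    with w , xw , w≢y ← another-neighbour two y
    with w ∈? (x ∷ y ∷ rest)
  ... | yes (here w≡x)                  = ⊥-elim (Adj⇒≢ xw (sym w≡x))
  ... | yes (there (here w≡y))          = ⊥-elim (w≢y w≡y)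
  ... | yes (there (there w∈rest))      = ⊥-elim (acyclic _ (chord⇒cycle path w∈rest xw))
  ... | no w∉path = w , (¬Any⇒All¬ _ w∉path ∷ uniq , Adj-sym xw ∷ linked)

  leafless⇒long-path : Acyclic G → (∀ v → deg G v ≢ 1) → ∀ {u v} → Adj G u v →
                       ∀ k → ∃ λ x → ∃ λ y → ∃ λ rest → length rest ≡ k × Path (x ∷ y ∷ rest)
  leafless⇒long-path acyclic leafless {u} {v} uv zero =
    u , v , [] , refl , ((Adj⇒≢ uv ∷ []) ∷ [] ∷ []) , uv ∷ [-]
  leafless⇒long-path acyclic leafless uv (suc k)
    with x , y , rest , len , path@(_ , xy ∷ _) ← leafless⇒long-path acyclic leafless uv k
    with w , wpath ← extend-path acyclic (≤∧≢⇒< (Adj⇒deg-pos xy) (leafless x ∘ sym)) path =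
    w , x , y ∷ rest , cong suc len , wpath

  acyclic⇒leaf : Acyclic G → ∀ {u v} → Adj G u v → ∃ λ w → deg G w ≡ 1
  acyclic⇒leaf acyclic uv with Fin.any? (λ w → deg G w ≟ 1)
  ... | yes leaf = leaf
  ... | no noLeaf with _ , _ , rest , len , uniq , _ ← leafless⇒long-path acyclic (λ w → noLeaf ∘ (w ,_)) uv n =
    ⊥-elim (<⇒≱ (s≤s (≤-trans (≤-reflexive (sym len)) (n≤1+n _))) (Unique⇒length≤n uniq))

infix 4 _⊆_
_⊆_ : Graph n → Graph n → Set
H ⊆ G = ∀ {x y} → Adj H x y → Adj G x y

Acyclic-⊆ : {G H : Graph n} → H ⊆ G → Acyclic G → Acyclic H
Acyclic-⊆ H⊆G acyclic (v ∷ vs) (three≤ , uniq , linked , closing) =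
  acyclic (v ∷ vs) (three≤ , uniq , Linked-map H⊆G linked , H⊆G closing)

degSum : Graph n → ℕ
degSum G = ∑ (deg G)

-- Vertex deletion on the same vertex set: u stays behind as an isolated vertex.
infixl 6 _-ᵛ_
_-ᵛ_ : Graph n → Fin n → Graph n
G -ᵛ u = record { adj = adj′ ; sym = sym′ ; irrefl = irrefl′ }
  where
  kept : Fin _ → Bool
  kept x = not (does (x Fin.≟ u))
  adj′ : Fin _ → Fin _ → Bool
  adj′ x y = adj G x y ∧ kept x ∧ kept y
  sym′ : ∀ x y → adj′ x y ≡ adj′ y x
  sym′ x y rewrite Graph.sym G x y | Bool.∧-comm (kept x) (kept y) = refl
  irrefl′ : ∀ x → adj′ x x ≡ false
  irrefl′ x rewrite irrefl G x = refl

deg-⊆ : {G H : Graph n} → H ⊆ G → ∀ v → deg H v ≤ deg G v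
deg-⊆ {G = G} {H} H⊆G v = begin
  deg H v                  ≡⟨ deg-∑ H v ⟩
  ∑ (λ w → 𝟙 (adj H v w))  ≤⟨ ∑-mono-≤ (λ w → 𝟙-mono (H⊆G {v} {w})) ⟩
  ∑ (λ w → 𝟙 (adj G v w))  ≡⟨ deg-∑ G v ⟨
  deg G v                  ∎
  where open ≤-Reasoning

module _ (G : Graph n) (u : Fin n) where

  -ᵛ-⊆ : G -ᵛ u ⊆ G
  -ᵛ-⊆ {x} {y} xy with adj G x y
  ... | true = refl

  adj-ᵛ-away : ∀ {x y} → x ≢ u → y ≢ u → adj (G -ᵛ u) x y ≡ adj G x y
  adj-ᵛ-away {x} {y} x≢u y≢u rewrite dec-false (x Fin.≟ u) x≢u | dec-false (y Fin.≟ u) y≢u = Bool.∧-identityʳ _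

  adj-ᵛ-to : ∀ x → adj (G -ᵛ u) x u ≡ false
  adj-ᵛ-to x rewrite dec-true (u Fin.≟ u) refl | Bool.∧-zeroʳ (not (does (x Fin.≟ u))) = Bool.∧-zeroʳ _

  deg-ᵛ-at : deg (G -ᵛ u) u ≡ 0
  deg-ᵛ-at = trans (deg-∑ (G -ᵛ u) u) (∑-zero (λ y → cong 𝟙 (trans (Graph.sym (G -ᵛ u) u y) (adj-ᵛ-to y))))

  deg-ᵛ : ∀ {x} → x ≢ u → deg G x ≡ deg (G -ᵛ u) x + 𝟙 (adj G x u)
  deg-ᵛ {x} x≢u = begin
    deg G x                                         ≡⟨ deg-∑ G x ⟩
    ∑ (λ y → 𝟙 (adj G x y))                         ≡⟨ +-identityʳ _ ⟨
    ∑ (λ y → 𝟙 (adj G x y)) + 0                     ≡⟨ cong (λ b → _ + 𝟙 b) (adj-ᵛ-to x) ⟨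
    ∑ (λ y → 𝟙 (adj G x y)) + 𝟙 (adj (G -ᵛ u) x u) ≡⟨ ∑-update u (λ y y≢u → cong 𝟙 (sym (adj-ᵛ-away x≢u y≢u))) ⟩
    ∑ (λ y → 𝟙 (adj (G -ᵛ u) x y)) + 𝟙 (adj G x u) ≡⟨ cong (_+ 𝟙 (adj G x u)) (deg-∑ (G -ᵛ u) x) ⟨
    deg (G -ᵛ u) x + 𝟙 (adj G x u)                  ∎
    where open ≡-Reasoning

  -- Removing u loses deg u edge ends at u and another deg u at its neighbours.
  degSum-ᵛ : degSum G ≡ degSum (G -ᵛ u) + (deg G u + deg G u)
  degSum-ᵛ = begin
    ∑ (deg G)                                      ≡⟨ +-identityʳ _ ⟨
    ∑ (deg G) + 0                                  ≡⟨ cong₂ (λ a b → ∑ (deg G) + (a + 𝟙 b)) deg-ᵛ-at (irrefl G u) ⟨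
    ∑ (deg G) + (deg (G -ᵛ u) u + 𝟙 (adj G u u))   ≡⟨ ∑-update u (λ x x≢u → deg-ᵛ x≢u) ⟩
    ∑ (λ x → deg (G -ᵛ u) x + 𝟙 (adj G x u)) + deg G u              ≡⟨ cong (_+ deg G u) (∑-distrib-+ (deg (G -ᵛ u)) _) ⟩
    ∑ (deg (G -ᵛ u)) + ∑ (λ x → 𝟙 (adj G x u)) + deg G u            ≡⟨ cong (λ s → ∑ (deg (G -ᵛ u)) + s + deg G u) ends-at-u ⟩
    ∑ (deg (G -ᵛ u)) + deg G u + deg G u                            ≡⟨ +-assoc (∑ (deg (G -ᵛ u))) (deg G u) (deg G u) ⟩
    ∑ (deg (G -ᵛ u)) + (deg G u + deg G u)                          ∎
    where
    open ≡-Reasoning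
    ends-at-u : ∑ (λ x → 𝟙 (adj G x u)) ≡ deg G u
    ends-at-u = trans (sum-cong-≗ (λ x → cong 𝟙 (Graph.sym G x u))) (sym (deg-∑ G u))

sgn : ℕ → ℕ
sgn zero    = 0
sgn (suc _) = 1

sgn-mono-≤ : ∀ {a b} → a ≤ b → sgn a ≤ sgn b
sgn-mono-≤ z≤n     = z≤n
sgn-mono-≤ (s≤s _) = ≤-refl

nonIsolated : Graph n → ℕ
nonIsolated G = ∑ (λ v → sgn (deg G v))

module _ {G : Graph n} (acyclic : Acyclic G) where

  remove-leaf : 1 ≤ degSum G → ∃ λ u → ∃ λ w → Adj G u w
                × degSum G ≡ degSum (G -ᵛ u) + 2
                × 1 + nonIsolated (G -ᵛ u) ≤ nonIsolated G
  remove-leaf pos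
    with v , v-pos ← ∑-positive (deg G) pos
    with _ , vv′ ← deg-pos⇒Adj G v-pos
    with u , deg-u ← acyclic⇒leaf G acyclic vv′
    with w , uw ← deg-pos⇒Adj G (≤-reflexive (sym deg-u)) =
    u , w , uw ,
    trans (degSum-ᵛ G u) (cong (λ d → degSum (G -ᵛ u) + (d + d)) deg-u) ,
    ∑-bump u (λ x → sgn-mono-≤ (deg-⊆ {G = G} {H = G -ᵛ u} (-ᵛ-⊆ G u) x))
             (subst (λ d → 1 + sgn d ≤ sgn (deg G u)) (sym (deg-ᵛ-at G u)) (sgn-mono-≤ (Adj⇒deg-pos G uw)))

forest-degSum : {G : Graph n} → Acyclic G → 1 ≤ degSum G → 2 + degSum G ≤ 2 * nonIsolated G
forest-degSum {n} {G} acyclic = <-rec P prune-leaf (degSum G) acyclic refl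
  where
  P : ℕ → Set
  P s = ∀ {G : Graph n} → Acyclic G → degSum G ≡ s → 1 ≤ s → 2 + s ≤ 2 * nonIsolated G
  prune-leaf : ∀ s → (∀ {s′} → s′ < s → P s′) → P s
  prune-leaf _ rec {G} acyclic refl pos
    with u , w , uw , sum-eq , bump ← remove-leaf acyclic pos
    with degSum (G -ᵛ u) in sum′-eq
  ... | zero = begin
    2 + degSum G             ≡⟨ cong (2 +_) sum-eq ⟩
    2 * 2                    ≤⟨ *-monoʳ-≤ 2 (length≤∑ (((Adj⇒≢ G uw) ∷ []) ∷ [] ∷ []) endpoint-pos) ⟩
    2 * nonIsolated G        ∎
    where
    open ≤-Reasoning
    endpoint-pos : ∀ {v} → v ∈ u ∷ w ∷ [] → 1 ≤ sgn (deg G v)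
    endpoint-pos (here refl)         = sgn-mono-≤ (Adj⇒deg-pos G uw)
    endpoint-pos (there (here refl)) = sgn-mono-≤ (Adj⇒deg-pos G (Adj-sym G uw))
  ... | suc s′ = begin
    2 + degSum G                      ≡⟨ cong (2 +_) sum-eq ⟩
    2 + (suc s′ + 2)                  ≡⟨ cong (2 +_) (+-comm (suc s′) 2) ⟩
    2 + (2 + suc s′)                  ≤⟨ +-monoʳ-≤ 2 (rec shorter (Acyclic-⊆ {H = G -ᵛ u} (-ᵛ-⊆ G u) acyclic) sum′-eq (s≤s z≤n)) ⟩
    2 + 2 * nonIsolated (G -ᵛ u)      ≡⟨ *-distribˡ-+ 2 1 _ ⟨
    2 * (1 + nonIsolated (G -ᵛ u))    ≤⟨ *-monoʳ-≤ 2 bump ⟩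
    2 * nonIsolated G                 ∎
    where
    open ≤-Reasoning
    shorter : suc s′ < degSum G
    shorter = subst (suc s′ <_) (sym sum-eq) (m<m+n (suc s′) (s≤s z≤n))

δ : ℕ → ℕ → ℕ
δ m i = 𝟙 (m ≡ᵇ i)

atLeast4 : ℕ → ℕ
atLeast4 (suc (suc (suc (suc _)))) = 1
atLeast4 _                         = 0

sum-applyUpTo-zero : ∀ k → sum (applyUpTo (λ _ → 0) k) ≡ 0
sum-applyUpTo-zero zero    = refl
sum-applyUpTo-zero (suc k) = sum-applyUpTo-zero k

sum-applyUpTo-δ : ∀ j k → j < k → sum (applyUpTo (δ j) k) ≡ 1
sum-applyUpTo-δ zero    (suc k) _         = cong suc (sum-applyUpTo-zero k)
sum-applyUpTo-δ (suc j) (suc k) (s≤s j<k) = sum-applyUpTo-δ j k j<k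

sum-δ-from4 : ∀ m k → m < 4 + k → sum (map (δ m) (applyUpTo (4 +_) k)) ≡ atLeast4 m
sum-δ-from4 m k m<4+k rewrite map-applyUpTo (4 +_) (δ m) k with m | m<4+k
... | 0 | _ = sum-applyUpTo-zero k
... | 1 | _ = sum-applyUpTo-zero k
... | 2 | _ = sum-applyUpTo-zero k
... | 3 | _ = sum-applyUpTo-zero k
... | suc (suc (suc (suc j))) | s≤s (s≤s (s≤s (s≤s j<k))) = sum-applyUpTo-δ j k j<k

module _ (G : Graph n) where

  d-∑ : ∀ i → d G i ≡ ∑ (λ v → δ (deg G v) i)
  d-∑ i = sum-map-allFin (λ v → δ (deg G v) i)

  sumDeg≥4-∑ : sumDeg≥4 G ≡ ∑ (λ v → atLeast4 (deg G v))
  sumDeg≥4-∑ = begin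
    sum (map (d G) range)                                 ≡⟨ cong sum (map-cong d-∑ range) ⟩
    sum (map (λ i → ∑ (λ v → δ (deg G v) i)) range)       ≡⟨ sum-map-∑ (λ i v → δ (deg G v) i) range ⟩
    ∑ (λ v → sum (map (δ (deg G v)) range))               ≡⟨ sum-cong-≗ (λ v → sum-δ-from4 (deg G v) (n ∸ 3) (deg<end v)) ⟩
    ∑ (λ v → atLeast4 (deg G v))                          ∎
    where
    open ≡-Reasoning
    range = applyUpTo (4 +_) (n ∸ 3)
    deg<end : ∀ v → deg G v < 4 + (n ∸ 3)
    deg<end v = s≤s (≤-trans (deg≤n G v) (m≤n+m∸n n 3))

degree-classes : ∀ m → 1 ≤ m → δ m 1 + δ m 2 + δ m 3 + atLeast4 m ≡ 1
degree-classes 1                          _ = refl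
degree-classes 2                          _ = refl
degree-classes 3                          _ = refl
degree-classes (suc (suc (suc (suc _)))) _ = refl

degree-excess : ∀ m → 1 ≤ m → 2 + (δ m 3 + (atLeast4 m + atLeast4 m)) ≤ m + δ m 1
degree-excess 1                          _ = ≤-refl
degree-excess 2                          _ = ≤-refl
degree-excess 3                          _ = ≤-refl
degree-excess (suc (suc (suc (suc k)))) _ = s≤s (s≤s (s≤s (s≤s z≤n)))

degree≥3-class : ∀ m → 3 ≤ m → 1 ≤ δ m 3 + atLeast4 m
degree≥3-class 1                          (s≤s ())
degree≥3-class 2                          (s≤s (s≤s ()))
degree≥3-class 3                          _ = ≤-refl
degree≥3-class (suc (suc (suc (suc _)))) _ = ≤-refl

module _ (G : Graph n) (deg-pos : ∀ v → 1 ≤ deg G v) where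

  private
    D : ℕ → Fin n → ℕ
    D i v = δ (deg G v) i
    A : Fin n → ℕ
    A v = atLeast4 (deg G v)

  count-partition : d G 1 + d G 2 + d G 3 + sumDeg≥4 G ≡ n
  count-partition = begin
    d G 1 + d G 2 + d G 3 + sumDeg≥4 G           ≡⟨ cong₂ _+_ (cong₂ _+_ (cong₂ _+_ (d-∑ G 1) (d-∑ G 2)) (d-∑ G 3)) (sumDeg≥4-∑ G) ⟩
    ∑ (D 1) + ∑ (D 2) + ∑ (D 3) + ∑ A            ≡⟨ cong (λ s → s + ∑ (D 3) + ∑ A) (∑-distrib-+ (D 1) (D 2)) ⟨
    ∑ (λ v → D 1 v + D 2 v) + ∑ (D 3) + ∑ A      ≡⟨ cong (_+ ∑ A) (∑-distrib-+ (λ v → D 1 v + D 2 v) (D 3)) ⟨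
    ∑ (λ v → D 1 v + D 2 v + D 3 v) + ∑ A        ≡⟨ ∑-distrib-+ (λ v → D 1 v + D 2 v + D 3 v) A ⟨
    ∑ (λ v → D 1 v + D 2 v + D 3 v + A v)        ≡⟨ sum-cong-≗ (λ v → degree-classes (deg G v) (deg-pos v)) ⟩
    ∑ {n} (λ _ → 1)                              ≡⟨ ∑-const {n} 1 ⟩
    n * 1                                        ≡⟨ *-identityʳ n ⟩
    n                                            ∎
    where open ≡-Reasoning

  count-excess : n * 2 + (d G 3 + (sumDeg≥4 G + sumDeg≥4 G)) ≤ degSum G + d G 1
  count-excess = begin
    n * 2 + (d G 3 + (sumDeg≥4 G + sumDeg≥4 G))  ≡⟨ cong₂ (λ a b → n * 2 + (a + (b + b))) (d-∑ G 3) (sumDeg≥4-∑ G) ⟩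
    n * 2 + (∑ (D 3) + (∑ A + ∑ A))              ≡⟨ cong₂ (λ a b → a + (∑ (D 3) + b)) (∑-const {n} 2) (∑-distrib-+ A A) ⟨
    ∑ {n} (λ _ → 2) + (∑ (D 3) + ∑ (λ v → A v + A v))  ≡⟨ cong (∑ {n} (λ _ → 2) +_) (∑-distrib-+ (D 3) _) ⟨
    ∑ {n} (λ _ → 2) + ∑ (λ v → D 3 v + (A v + A v))    ≡⟨ ∑-distrib-+ {n} (λ _ → 2) _ ⟨
    ∑ (λ v → 2 + (D 3 v + (A v + A v)))          ≤⟨ ∑-mono-≤ (λ v → degree-excess (deg G v) (deg-pos v)) ⟩
    ∑ (λ v → deg G v + D 1 v)                    ≡⟨ ∑-distrib-+ (deg G) (D 1) ⟩
    degSum G + ∑ (D 1)                           ≡⟨ cong (degSum G +_) (d-∑ G 1) ⟨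
    degSum G + d G 1                             ∎
    where open ≤-Reasoning

  count-≥3 : ∀ {xs : List (Fin n)} → Unique xs → (∀ {v} → v ∈ xs → 3 ≤ deg G v) →
             length xs ≤ d G 3 + sumDeg≥4 G
  count-≥3 {xs} uniq ≥3 = begin
    length xs                       ≤⟨ length≤∑ uniq (λ v∈xs → degree≥3-class _ (≥3 v∈xs)) ⟩
    ∑ (λ v → D 3 v + A v)           ≡⟨ ∑-distrib-+ (D 3) A ⟩
    ∑ (D 3) + ∑ A                   ≡⟨ cong₂ _+_ (d-∑ G 3) (sumDeg≥4-∑ G) ⟨
    d G 3 + sumDeg≥4 G              ∎
    where open ≤-Reasoning

degree-count-bounds : ∀ {n b x₁ x₂ x₃ s} → x₁ + x₂ + x₃ + s ≡ n → 2 + (x₃ + (s + s)) ≤ x₁ → b ≤ x₃ + s →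
  (x₁ ∸ b ≥ 2 + s × b ≤ x₁) × 3 * x₁ ≥ 2 * (n ∸ (x₂ + x₃)) × 3 * s ≤ n ∸ (x₂ + x₃)
degree-count-bounds {n} {b} {x₁} {x₂} {x₃} {s} partition leaves b≤ =
  (m+n≤o⇒m≤o∸n (2 + s) 2+s+b≤x₁ , m+n≤o⇒n≤o (2 + s) 2+s+b≤x₁) ,
  subst (λ r → 2 * r ≤ 3 * x₁) (sym rest) (begin
    2 * (x₁ + s)       ≡⟨ solve 2 (λ x y → con 2 :* (x :+ y) := x :+ x :+ (y :+ y)) refl x₁ s ⟩
    x₁ + x₁ + (s + s)  ≤⟨ +-monoʳ-≤ (x₁ + x₁) s+s≤x₁ ⟩
    x₁ + x₁ + x₁       ≡⟨ solve 1 (λ x → x :+ x :+ x := con 3 :* x) refl x₁ ⟩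
    3 * x₁             ∎) ,
  subst (3 * s ≤_) (sym rest) (begin
    3 * s              ≡⟨ solve 1 (λ y → con 3 :* y := y :+ y :+ y) refl s ⟩
    s + s + s          ≤⟨ +-monoˡ-≤ s s+s≤x₁ ⟩
    x₁ + s             ∎)
  where
  open ≤-Reasoning
  open +-*-Solver
  rest : n ∸ (x₂ + x₃) ≡ x₁ + s
  rest = begin-equality
    n ∸ (x₂ + x₃)                  ≡⟨ cong (_∸ (x₂ + x₃)) partition ⟨
    x₁ + x₂ + x₃ + s ∸ (x₂ + x₃)   ≡⟨ cong (_∸ (x₂ + x₃)) (solve 4 (λ a b c y → a :+ b :+ c :+ y := a :+ y :+ (b :+ c)) refl x₁ x₂ x₃ s) ⟩
    x₁ + s + (x₂ + x₃) ∸ (x₂ + x₃) ≡⟨ m+n∸n≡m (x₁ + s) (x₂ + x₃) ⟩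
    x₁ + s                         ∎
  s+s≤x₁ : s + s ≤ x₁
  s+s≤x₁ = ≤-trans (m≤n+m (s + s) (2 + x₃)) (≤-trans (≤-reflexive (+-assoc 2 x₃ (s + s))) leaves)
  2+s+b≤x₁ : 2 + s + b ≤ x₁
  2+s+b≤x₁ = begin
    2 + s + b           ≤⟨ +-monoʳ-≤ (2 + s) b≤ ⟩
    2 + s + (x₃ + s)    ≡⟨ solve 2 (λ c y → con 2 :+ y :+ (c :+ y) := con 2 :+ (c :+ (y :+ y))) refl x₃ s ⟩
    2 + (x₃ + (s + s))  ≤⟨ leaves ⟩
    x₁                  ∎

walk⇒Adj : {G : Graph n} {P : Fin n → Set} {u v : Fin n} → WalkIn G P u v → u ≢ v → ∃ λ w → Adj G u w
walk⇒Adj (here _)      u≢u = ⊥-elim (u≢u refl)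
walk⇒Adj (step _ uw _) _   = _ , uw

connected⇒deg-pos : {G : Graph (suc (suc n))} → Connected G → ∀ v → 1 ≤ deg G v
connected⇒deg-pos {G = G} connected zero    = Adj⇒deg-pos G (proj₂ (walk⇒Adj (connected zero (suc zero)) λ ()))
connected⇒deg-pos {G = G} connected (suc v) = Adj⇒deg-pos G (proj₂ (walk⇒Adj (connected (suc v) zero) λ ()))

tree-degSum : {G : Graph (suc n)} → Acyclic G → (∀ v → 1 ≤ deg G v) → 2 + degSum G ≤ 2 * suc n
tree-degSum {n} {G} acyclic deg-pos = begin
  2 + degSum G          ≤⟨ forest-degSum acyclic (≤-trans (deg-pos zero) (term≤∑ (deg G) zero)) ⟩
  2 * nonIsolated G     ≡⟨ cong (2 *_) (trans (sum-cong-≗ (λ v → sgn-pos (deg-pos v))) (trans (∑-const {suc n} 1) (*-identityʳ (suc n)))) ⟩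
  2 * suc n             ∎
  where
  open ≤-Reasoning
  sgn-pos : ∀ {m} → 1 ≤ m → sgn m ≡ 1
  sgn-pos (s≤s _) = refl

leaf-bound : {G : Graph (suc n)} → Acyclic G → (deg-pos : ∀ v → 1 ≤ deg G v) →
             2 + (d G 3 + (sumDeg≥4 G + sumDeg≥4 G)) ≤ d G 1
leaf-bound {n} {G} acyclic deg-pos = +-cancelˡ-≤ (degSum G) _ _ (begin
  degSum G + (2 + excess)  ≡⟨ x∙yz≈y∙xz (degSum G) 2 excess ⟩
  2 + degSum G + excess    ≤⟨ +-monoˡ-≤ excess (tree-degSum acyclic deg-pos) ⟩
  2 * suc n + excess       ≡⟨ cong (_+ excess) (*-comm 2 (suc n)) ⟩
  suc n * 2 + excess       ≤⟨ count-excess G deg-pos ⟩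
  degSum G + d G 1         ∎)
  where
  open ≤-Reasoning
  excess = d G 3 + (sumDeg≥4 G + sumDeg≥4 G)

lemma3 : (n : ℕ) → n ≥ 2 → (T : Graph n) → IsTree T →
    (b : ℕ) → HasCount (Bad T) b →
    (d T 1 ∸ b ≥ 2 + sumDeg≥4 T × b ≤ d T 1)
    × 3 * d T 1 ≥ 2 * (n ∸ (d T 2 + d T 3))
    × 3 * sumDeg≥4 T ≤ n ∸ (d T 2 + d T 3)
lemma3 _ (s≤s (s≤s _)) T (connected , acyclic) _ (bad , uniq , bad⇔ , refl) =
  degree-count-bounds (count-partition T deg-pos) (leaf-bound acyclic deg-pos)
    (count-≥3 T deg-pos uniq (λ v∈bad → proj₁ (Equivalence.to (bad⇔ _) v∈bad)))
  where
  deg-pos : ∀ v → 1 ≤ deg T v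
  deg-pos = connected⇒deg-pos connected
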